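{- Let $G$ be a finite simple graph and $\alpha,\alpha'$ acyclic orientations of $G$. Then $\alpha$ and $\alpha'$ are flip equivalent if and only if $\alpha'$ can be reached from $\alpha$ by a sequence of inflips. Similarly, $\alpha$ and $\alpha'$ are flip equivalent if and only if $\alpha'$ can be reached from $\alpha$ by a sequence of outflips.
   Context: An acyclic orientation of $G$ is an assignment of a direction to each edge with no directed cycle. A flip converts a source of an acyclic orientation into a sink, or a sink into a source, by reversing all edges incident to that vertex (this applies also to isolated vertices). An inflip converts a source into a sink; an outflip converts a sink into a source. Two acyclic orientations are flip equivalent if one can be reached from the other by a sequence of flips. -}

module Defs where

open import Data.Nat using (ℕ)
open import Data.Fin using (Fin)
open import Data.Bool using (Bool; true; false)
open import Data.Product using (_×_; Σ)
open import Data.Sum using (_⊎_)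
open import Relation.Nullary using (¬_)
open import Relation.Binary.PropositionalEquality using (_≡_; _≢_)
open import Relation.Binary.Construct.Closure.Transitive using (TransClosure)
open import Relation.Binary.Construct.Closure.ReflexiveTransitive using (Star)

record Graph (n : ℕ) : Set where
  field
    adj   : Fin n → Fin n → Bool
    sym   : ∀ u v → adj u v ≡ adj v u
    irrfl : ∀ v → adj v v ≡ false
open Graph public

record Orientation {n : ℕ} (G : Graph n) : Set where
  field
    arc      : Fin n → Fin n → Bool
    arc-edge : ∀ u v → arc u v ≡ true → adj G u v ≡ true
    edge-arc : ∀ u v → adj G u v ≡ true → (arc u v ≡ true) ⊎ (arc v u ≡ true)
    antisym  : ∀ u v → arc u v ≡ true → arc v u ≡ false
open Orientation public

Arc : ∀ {n} {G : Graph n} → Orientation G → Fin n → Fin n → Set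
Arc α u v = arc α u v ≡ true

Acyclic : ∀ {n} {G : Graph n} → Orientation G → Set
Acyclic {n} α = ∀ (v : Fin n) → ¬ TransClosure (Arc α) v v

record AcyclicOrientation {n : ℕ} (G : Graph n) : Set where
  field
    ori     : Orientation G
    acyclic : Acyclic ori
open AcyclicOrientation public

IsSource : ∀ {n} {G : Graph n} → Orientation G → Fin n → Set
IsSource α v = ∀ u → arc α u v ≡ false

IsSink : ∀ {n} {G : Graph n} → Orientation G → Fin n → Set
IsSink α v = ∀ u → arc α v u ≡ false

ReverseAt : ∀ {n} {G : Graph n} → Fin n → Orientation G → Orientation G → Set
ReverseAt {n} v α β =
  (∀ u w → u ≢ v → w ≢ v → arc β u w ≡ arc α u w)
  × (∀ u → arc β u v ≡ arc α v u)
  × (∀ u → arc β v u ≡ arc α u v)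

InflipStep : ∀ {n} {G : Graph n} → AcyclicOrientation G → AcyclicOrientation G → Set
InflipStep {n} α β = Σ (Fin n) λ v → IsSource (ori α) v × ReverseAt v (ori α) (ori β)

OutflipStep : ∀ {n} {G : Graph n} → AcyclicOrientation G → AcyclicOrientation G → Set
OutflipStep {n} α β = Σ (Fin n) λ v → IsSink (ori α) v × ReverseAt v (ori α) (ori β)

FlipStep : ∀ {n} {G : Graph n} → AcyclicOrientation G → AcyclicOrientation G → Set
FlipStep α β = InflipStep α β ⊎ OutflipStep α β

FlipEquivalent : ∀ {n} {G : Graph n} → AcyclicOrientation G → AcyclicOrientation G → Set
FlipEquivalent = Star FlipStep

InflipReachable : ∀ {n} {G : Graph n} → AcyclicOrientation G → AcyclicOrientation G → Set
InflipReachable = Star InflipStep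

OutflipReachable : ∀ {n} {G : Graph n} → AcyclicOrientation G → AcyclicOrientation G → Set
OutflipReachable = Star OutflipStep

-- An outflip at a sink v is simulated by inflipping every other vertex once, in a
-- topological order of α. Inflipping, one by one, the vertices of a growing down-set S
-- (each is a source when its turn comes, being minimal among the vertices not yet
-- flipped) reverses exactly the edges crossing S; for S = V ∖ {v} these are the edges
-- at v. Dually, an inflip α → α′ is the converse of the outflip α′ → α, and reversing
-- the inflip sequence simulating the latter yields a sequence of outflips.
module Submission where

open import Defs hiding (sym)
open import Algebra.Bundles using (CommutativeRing)
import Algebra.Properties.CommutativeSemigroup as CommutativeSemigroupProperties
open import Data.Bool using (Bool; true; false; not; _xor_; _∨_; if_then_else_)
import Data.Bool as Bool
open import Data.Bool.Properties
  using (if-xor; xor-comm; xor-annihilates-not; xor-∧-commutativeRing; ¬-not)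
open import Data.Fin using (Fin; _≟_)
open import Data.Fin.Induction using (spo-wellFounded)
open import Data.Fin.Properties using (any?)
open import Data.Fin.Subset using (_∈_; _⊂_; _⊃_)
open import Data.Fin.Subset.Induction using (⊃-wellFounded)
open import Data.Nat using (ℕ)
open import Data.Product using (∃; ∃-syntax; _×_; _,_; proj₁)
open import Data.Sum using (_⊎_; inj₁; inj₂; [_,_]′)
open import Data.Vec using (tabulate)
open import Data.Vec.Properties using (lookup∘tabulate; lookup⇒[]=; []=⇒lookup)
open import Function.Bundles using (_⇔_; mk⇔; Equivalence)
open import Induction.WellFounded using (WellFounded; Acc; acc)
open import Relation.Binary using (Rel; Decidable; IsStrictPartialOrder)
open import Relation.Binary.Construct.Closure.ReflexiveTransitive
  using (Star; ε; _◅_; _⋆; return; reverse)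
import Relation.Binary.Construct.Closure.ReflexiveTransitive as Star
open import Relation.Binary.Construct.Closure.Transitive
  using (TransClosure; [_]; _∷_; _++_; wellFounded⁻)
open import Relation.Binary.PropositionalEquality
open import Relation.Nullary using (¬_; Dec; yes; no; does; contradiction)
open import Relation.Nullary.Decidable using (¬?; _×-dec_)
open import Relation.Unary using (Pred)
import Relation.Unary as U

open CommutativeSemigroupProperties
  (CommutativeRing.+-commutativeSemigroup xor-∧-commutativeRing)
  using (interchange)

module _ {n r p} {_<_ : Rel (Fin n) r} (<-wf : WellFounded _<_) (_<?_ : Decidable _<_)
         {P : Pred (Fin n) p} (P? : U.Decidable P) where

  minimal : ∀ {w} → P w → ∃[ s ] P s × (∀ {u} → P u → ¬ u < s)
  minimal {w} = descend (<-wf w)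
    where
    descend : ∀ {w} → Acc _<_ w → P w → ∃[ s ] P s × (∀ {u} → P u → ¬ u < s)
    descend {w} (acc rec) Pw with any? (λ u → P? u ×-dec u <? w)
    ... | yes (u , Pu , u<w) = descend (rec u<w) Pu
    ... | no ∄ = w , Pw , λ Pu u<w → ∄ (_ , Pu , u<w)

module _ {n : ℕ} where

  _⊆ᵇ_ : (S T : Fin n → Bool) → Set
  S ⊆ᵇ T = ∀ u → S u ≡ true → T u ≡ true

  tabulate-⊂ : ∀ {S T : Fin n → Bool} → S ⊆ᵇ T → ∀ {w} → T w ≡ true → S w ≡ false →
               tabulate S ⊂ tabulate T
  tabulate-⊂ {S} {T} S⊆T {w} Tw Sw =
    (λ u∈S → ∈-tabulate⁺ T (S⊆T _ (∈-tabulate⁻ S u∈S))) ,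
    w , ∈-tabulate⁺ T Tw , λ w∈S → contradiction (trans (sym (∈-tabulate⁻ S w∈S)) Sw) λ ()
    where
    ∈-tabulate⁺ : ∀ (R : Fin n → Bool) {u} → R u ≡ true → u ∈ tabulate R
    ∈-tabulate⁺ R {u} Ru = lookup⇒[]= u (tabulate R) (trans (lookup∘tabulate R u) Ru)
    ∈-tabulate⁻ : ∀ (R : Fin n → Bool) {u} → u ∈ tabulate R → R u ≡ true
    ∈-tabulate⁻ R {u} u∈R = trans (sym (lookup∘tabulate R u)) ([]=⇒lookup u∈R)

  ⁅_⁆ : Fin n → Fin n → Bool
  ⁅ v ⁆ u = does (u ≟ v)

  _∪⁅_⁆ : (Fin n → Bool) → Fin n → Fin n → Bool
  (S ∪⁅ s ⁆) u = ⁅ s ⁆ u ∨ S u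

  ∪⁅⁆-⊇ : ∀ S s → S ⊆ᵇ (S ∪⁅ s ⁆)
  ∪⁅⁆-⊇ S s u Su with u ≟ s
  ... | yes _ = refl
  ... | no _ = Su

  ∪⁅⁆-∋ : ∀ S s → (S ∪⁅ s ⁆) s ≡ true
  ∪⁅⁆-∋ S s with s ≟ s
  ... | yes _ = refl
  ... | no s≢s = contradiction refl s≢s

  _≐_ : (a b : Fin n → Fin n → Bool) → Set
  a ≐ b = ∀ u w → a u w ≡ b u w

  reverseAcross : (Fin n → Bool) → (Fin n → Fin n → Bool) → Fin n → Fin n → Bool
  reverseAcross S a u w = if S u xor S w then a w u else a u w

  reverseAcross-dichotomy : ∀ S a u w →
    (reverseAcross S a u w ≡ a w u × reverseAcross S a w u ≡ a u w) ⊎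
    (reverseAcross S a u w ≡ a u w × reverseAcross S a w u ≡ a w u)
  reverseAcross-dichotomy S a u w with S u | S w
  ... | true  | true  = inj₂ (refl , refl)
  ... | true  | false = inj₁ (refl , refl)
  ... | false | true  = inj₁ (refl , refl)
  ... | false | false = inj₂ (refl , refl)

  reverseAcross-congˡ : ∀ {S S′} a → (∀ u → S u ≡ S′ u) → reverseAcross S a ≐ reverseAcross S′ a
  reverseAcross-congˡ _ S≗S′ u w =
    cong (λ c → if c then _ else _) (cong₂ _xor_ (S≗S′ u) (S≗S′ w))

  reverseAcross-congʳ : ∀ S {a b} → a ≐ b → reverseAcross S a ≐ reverseAcross S b
  reverseAcross-congʳ S a≐b u w =
    cong₂ (λ x y → if S u xor S w then x else y) (a≐b w u) (a≐b u w)

  reverseAcross-∁ : ∀ S a → reverseAcross (λ u → not (S u)) a ≐ reverseAcross S a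
  reverseAcross-∁ S _ u w = cong (λ c → if c then _ else _) (xor-annihilates-not (S u) (S w))

  reverseAcross-xor : ∀ S T a →
    reverseAcross S (reverseAcross T a) ≐ reverseAcross (λ u → S u xor T u) a
  reverseAcross-xor S T a u w = begin
    (if S u xor S w
       then (if T w xor T u then a u w else a w u)
       else (if T u xor T w then a w u else a u w))
      ≡⟨ cong (λ c → if S u xor S w then (if c then a u w else a w u)
                                      else (if T u xor T w then a w u else a u w))
              (xor-comm (T w) (T u)) ⟩
    (if S u xor S w
       then (if T u xor T w then a u w else a w u)
       else (if T u xor T w then a w u else a u w))
      ≡⟨ if-xor (S u xor S w) ⟨
    (if (S u xor S w) xor (T u xor T w) then a w u else a u w)
      ≡⟨ cong (λ c → if c then a w u else a u w) (interchange (S u) (S w) (T u) (T w)) ⟩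
    (if (S u xor T u) xor (S w xor T w) then a w u else a u w)
      ∎
    where open ≡-Reasoning

  reverseAcross-insert : ∀ {S s} a → S s ≡ false →
    reverseAcross ⁅ s ⁆ (reverseAcross S a) ≐ reverseAcross (S ∪⁅ s ⁆) a
  reverseAcross-insert {S} {s} a Ss u w =
    trans (reverseAcross-xor ⁅ s ⁆ S a u w) (reverseAcross-congˡ a xor≡∨ u w)
    where
    xor≡∨ : ∀ u → ⁅ s ⁆ u xor S u ≡ (S ∪⁅ s ⁆) u
    xor≡∨ u with u ≟ s
    ... | yes refl rewrite Ss = refl
    ... | no _ = refl

module _ {n} {G : Graph n} where

  arc-irreflexive : ∀ (o : Orientation G) v → arc o v v ≡ false
  arc-irreflexive o v =
    ¬-not λ v→v → contradiction (trans (sym (arc-edge o v v v→v)) (irrfl G v)) λ ()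

  Arc? : ∀ (o : Orientation G) → Decidable (Arc o)
  Arc? o u w = arc o u w Bool.≟ true

  Arc-wellFounded : ∀ (α : AcyclicOrientation G) → WellFounded (Arc (ori α))
  Arc-wellFounded α = wellFounded⁻ _ (spo-wellFounded isStrictPartialOrder)
    where
    isStrictPartialOrder : IsStrictPartialOrder _≡_ (TransClosure (Arc (ori α)))
    isStrictPartialOrder = record
      { isEquivalence = isEquivalence
      ; irrefl        = λ { refl → acyclic α _ }
      ; trans         = _++_
      ; <-resp-≈      = resp₂ _
      }

  reverseAcrossᵒ : (Fin n → Bool) → Orientation G → Orientation G
  reverseAcrossᵒ S γ = record
    { arc      = reverseAcross S (arc γ)
    ; arc-edge = edge
    ; edge-arc = oriented
    ; antisym  = antisymmetric
    }
    where
    edge : ∀ u w → reverseAcross S (arc γ) u w ≡ true → adj G u w ≡ true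
    edge u w h with reverseAcross-dichotomy S (arc γ) u w
    ... | inj₁ (uw , _) = trans (Graph.sym G u w) (arc-edge γ w u (trans (sym uw) h))
    ... | inj₂ (uw , _) = arc-edge γ u w (trans (sym uw) h)
    oriented : ∀ u w → adj G u w ≡ true →
               reverseAcross S (arc γ) u w ≡ true ⊎ reverseAcross S (arc γ) w u ≡ true
    oriented u w e with reverseAcross-dichotomy S (arc γ) u w | edge-arc γ u w e
    ... | inj₁ (_ , wu) | inj₁ h = inj₂ (trans wu h)
    ... | inj₁ (uw , _) | inj₂ h = inj₁ (trans uw h)
    ... | inj₂ (uw , _) | inj₁ h = inj₁ (trans uw h)
    ... | inj₂ (_ , wu) | inj₂ h = inj₂ (trans wu h)
    antisymmetric : ∀ u w → reverseAcross S (arc γ) u w ≡ true → reverseAcross S (arc γ) w u ≡ false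
    antisymmetric u w h with reverseAcross-dichotomy S (arc γ) u w
    ... | inj₁ (uw , wu) = trans wu (antisym γ w u (trans (sym uw) h))
    ... | inj₂ (uw , wu) = trans wu (antisym γ u w (trans (sym uw) h))

  ReverseAt⇔reverseAcross : ∀ v (γ β : Orientation G) →
    ReverseAt v γ β ⇔ (arc β ≐ reverseAcross ⁅ v ⁆ (arc γ))
  ReverseAt⇔reverseAcross v γ β = mk⇔ to from
    where
    to : ReverseAt v γ β → arc β ≐ reverseAcross ⁅ v ⁆ (arc γ)
    to (away , into , out) u w with u ≟ v | w ≟ v
    ... | yes refl | yes refl = into u
    ... | yes refl | no _     = out w
    ... | no _     | yes refl = into u
    ... | no u≢v   | no w≢v   = away u w u≢v w≢v
    from : arc β ≐ reverseAcross ⁅ v ⁆ (arc γ) → ReverseAt v γ β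
    from β≐ = away , into , out
      where
      away : ∀ u w → u ≢ v → w ≢ v → arc β u w ≡ arc γ u w
      away u w u≢v w≢v with u ≟ v | w ≟ v | β≐ u w
      ... | yes u≡v | _       | _ = contradiction u≡v u≢v
      ... | no _    | yes w≡v | _ = contradiction w≡v w≢v
      ... | no _    | no _    | e = e
      into : ∀ u → arc β u v ≡ arc γ v u
      into u with u ≟ v | v ≟ v | β≐ u v
      ... | _        | no v≢v | _ = contradiction refl v≢v
      ... | yes refl | yes _  | e = e
      ... | no _     | yes _  | e = e
      out : ∀ w → arc β v w ≡ arc γ w v
      out w with v ≟ v | w ≟ v | β≐ v w
      ... | no v≢v | _        | _ = contradiction refl v≢v
      ... | yes _  | yes refl | e = e
      ... | yes _  | no _     | e = e

  ReverseAt-sym : ∀ {v} (γ β : Orientation G) → ReverseAt v γ β → ReverseAt v β γ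
  ReverseAt-sym _ _ (away , into , out) =
    (λ u w u≢v w≢v → sym (away u w u≢v w≢v)) , (λ u → sym (out u)) , (λ u → sym (into u))

  source-becomes-sink : ∀ {s} (γ β : Orientation G) → IsSource γ s → ReverseAt s γ β → IsSink β s
  source-becomes-sink _ _ src (_ , _ , out) u = trans (out u) (src u)

  sink-starts-no-path : ∀ {s w} (β : Orientation G) → IsSink β s → ¬ TransClosure (Arc β) s w
  sink-starts-no-path _ snk [ s→w ]  = contradiction (trans (sym s→w) (snk _)) λ ()
  sink-starts-no-path _ snk (s→x ∷ _) = contradiction (trans (sym s→x) (snk _)) λ ()

  module _ {s} (γ β : Orientation G) (src : IsSource γ s) (rev : ReverseAt s γ β) where

    private
      s-sink : IsSink β s
      s-sink = source-becomes-sink γ β src rev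

    path-avoiding : ∀ {x y} → TransClosure (Arc β) x y → x ≢ s → y ≢ s → TransClosure (Arc γ) x y
    path-avoiding {x} {y} [ x→y ] x≢s y≢s = [ trans (sym (proj₁ rev x y x≢s y≢s)) x→y ]
    path-avoiding {x} (_∷_ {y = z} x→z z→⁺y) x≢s y≢s with z ≟ s
    ... | yes refl = contradiction z→⁺y (sink-starts-no-path β s-sink)
    ... | no z≢s   = trans (sym (proj₁ rev x z x≢s z≢s)) x→z ∷ path-avoiding z→⁺y z≢s y≢s

    inflip-acyclic : Acyclic γ → Acyclic β
    inflip-acyclic γ-acyclic v v→⁺v with v ≟ s
    ... | yes refl = sink-starts-no-path β s-sink v→⁺v
    ... | no v≢s   = γ-acyclic v (path-avoiding v→⁺v v≢s v≢s)

  inflip : ∀ (γ : AcyclicOrientation G) {s} → IsSource (ori γ) s → AcyclicOrientation G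
  inflip γ {s} src = record
    { ori     = γ′
    ; acyclic = inflip-acyclic (ori γ) γ′ src
                  (Equivalence.from (ReverseAt⇔reverseAcross s (ori γ) γ′) λ _ _ → refl) (acyclic γ)
    }
    where
    γ′ : Orientation G
    γ′ = reverseAcrossᵒ ⁅ s ⁆ (ori γ)

  inflip-converse : ∀ {α β : AcyclicOrientation G} → InflipStep α β → OutflipStep β α
  inflip-converse {α} {β} (v , src , rev) =
    v , source-becomes-sink (ori α) (ori β) src rev , ReverseAt-sym (ori α) (ori β) rev

module _ {n} {G : Graph n} (α : AcyclicOrientation G) where

  DownClosed : (Fin n → Bool) → Set
  DownClosed S = ∀ {u w} → Arc (ori α) u w → S w ≡ true → S u ≡ true

  module _ {T : Fin n → Bool} (T-down : DownClosed T)
           (δ : AcyclicOrientation G) (δ-arcs : arc (ori δ) ≐ reverseAcross T (arc (ori α))) where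

    Pending : (Fin n → Bool) → Pred (Fin n) _
    Pending S u = T u ≡ true × S u ≡ false

    pending? : ∀ S → U.Decidable (Pending S)
    pending? S u = (T u Bool.≟ true) ×-dec (S u Bool.≟ false)

    module MinimalPending {S} (S-down : DownClosed S) (S⊆T : S ⊆ᵇ T)
      {s} (Ts : T s ≡ true) (Ss : S s ≡ false) (s-min : ∀ {u} → Pending S u → ¬ Arc (ori α) u s)
      (γ : AcyclicOrientation G) (γ-arcs : arc (ori γ) ≐ reverseAcross S (arc (ori α))) where

      source : IsSource (ori γ) s
      source u rewrite γ-arcs u s | Ss with S u in Su
      ... | true  = ¬-not λ s→u → contradiction (trans (sym (S-down s→u Su)) Ss) λ ()
      ... | false = ¬-not λ u→s → s-min (T-down u→s Ts , Su) u→s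

      S′ : Fin n → Bool
      S′ = S ∪⁅ s ⁆

      S′-down : DownClosed S′
      S′-down {u} {w} u→w S′w with w ≟ s | u ≟ s
      ... | _        | yes _ = refl
      ... | yes refl | no _  = ¬-not λ Su → s-min (T-down u→w Ts , Su) u→w
      ... | no _     | no _  = S-down u→w S′w

      S′⊆T : S′ ⊆ᵇ T
      S′⊆T u S′u with u ≟ s
      ... | yes refl = Ts
      ... | no _     = S⊆T u S′u

      S⊂S′ : tabulate S ⊂ tabulate S′
      S⊂S′ = tabulate-⊂ (∪⁅⁆-⊇ S s) (∪⁅⁆-∋ S s) Ss

      γ′ : AcyclicOrientation G
      γ′ = inflip γ source

      γ′-arcs : arc (ori γ′) ≐ reverseAcross S′ (arc (ori α))
      γ′-arcs u w =
        trans (reverseAcross-congʳ ⁅ s ⁆ γ-arcs u w) (reverseAcross-insert (arc (ori α)) Ss u w)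

      step : ∀ (β : AcyclicOrientation G) → arc (ori β) ≐ reverseAcross S′ (arc (ori α)) →
             InflipStep γ β
      step β β-arcs = s , source ,
        Equivalence.from (ReverseAt⇔reverseAcross s (ori γ) (ori β))
          (λ u w → trans (β-arcs u w) (sym (γ′-arcs u w)))

    inflips-from : ∀ {S} → Acc _⊃_ (tabulate S) → DownClosed S → S ⊆ᵇ T → ∃ (Pending S) →
                   (γ : AcyclicOrientation G) → arc (ori γ) ≐ reverseAcross S (arc (ori α)) →
                   Star InflipStep γ δ
    inflips-from {S} (acc rec) S-down S⊆T (_ , Pw) γ γ-arcs
      with s , (Ts , Ss) , s-min ← minimal (Arc-wellFounded α) (Arc? (ori α)) (pending? S) Pw
      = continue (any? (pending? S′))
      where
      open MinimalPending S-down S⊆T Ts Ss s-min γ γ-arcs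
      continue : Dec (∃ (Pending S′)) → Star InflipStep γ δ
      continue (yes pending) =
        step γ′ γ′-arcs ◅ inflips-from (rec S⊂S′) S′-down S′⊆T pending γ′ γ′-arcs
      continue (no ∄) = step δ δ-arcs′ ◅ ε
        where
        T≗S′ : ∀ u → T u ≡ S′ u
        T≗S′ u with T u in Tu | S′ u in S′u
        ... | true  | true  = refl
        ... | false | false = refl
        ... | true  | false = contradiction (u , Tu , S′u) ∄
        ... | false | true  = contradiction (trans (sym (S′⊆T u S′u)) Tu) λ ()
        δ-arcs′ : arc (ori δ) ≐ reverseAcross S′ (arc (ori α))
        δ-arcs′ u w = trans (δ-arcs u w) (reverseAcross-congˡ (arc (ori α)) T≗S′ u w)

    inflips-between-downsets :
      ∀ S → DownClosed S → S ⊆ᵇ T → ∃ (Pending S) →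
      (γ : AcyclicOrientation G) → arc (ori γ) ≐ reverseAcross S (arc (ori α)) →
      Star InflipStep γ δ
    inflips-between-downsets S = inflips-from (⊃-wellFounded (tabulate S))

module _ {n} {G : Graph n} where

  outflip⇒inflips : ∀ {α α′ : AcyclicOrientation G} → OutflipStep α α′ → Star InflipStep α α′
  outflip⇒inflips {α} {α′} (v , v-sink , rev) with any? (λ u → ¬? (u ≟ v))
  ... | yes (u , u≢v) =
    inflips-between-downsets α T-down α′ α′-arcs
      (λ _ → false) (λ _ ()) (λ _ ()) (u , T-∋ u≢v , refl) α (λ _ _ → refl)
    where
    T : Fin n → Bool
    T u = not (⁅ v ⁆ u)
    T-∋ : ∀ {u} → u ≢ v → T u ≡ true
    T-∋ {u} u≢v with u ≟ v
    ... | yes u≡v = contradiction u≡v u≢v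
    ... | no _    = refl
    T-down : DownClosed α T
    T-down {u} {w} u→w _ with u ≟ v
    ... | yes refl = contradiction (trans (sym u→w) (v-sink w)) λ ()
    ... | no _     = refl
    α′-arcs : arc (ori α′) ≐ reverseAcross T (arc (ori α))
    α′-arcs u w = trans (Equivalence.to (ReverseAt⇔reverseAcross v (ori α) (ori α′)) rev u w)
                        (sym (reverseAcross-∁ ⁅ v ⁆ (arc (ori α)) u w))
  -- Otherwise v is the only vertex, so it is a source as well.
  ... | no ∄ = return (v , v-source , rev)
    where
    v-source : IsSource (ori α) v
    v-source u with u ≟ v
    ... | yes refl = arc-irreflexive (ori α) v
    ... | no u≢v   = contradiction (u , u≢v) ∄

  inflip⇒outflips : ∀ {α α′ : AcyclicOrientation G} → InflipStep α α′ → Star OutflipStep α α′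
  inflip⇒outflips {α} {α′} i =
    reverse (λ {β γ} → inflip-converse {α = β} {γ})
            (outflip⇒inflips (inflip-converse {α = α} {α′} i))

proposition2p2 : ∀ {n : ℕ} (G : Graph n) (α α′ : AcyclicOrientation G) →
    (FlipEquivalent α α′ ⇔ InflipReachable α α′) × (FlipEquivalent α α′ ⇔ OutflipReachable α α′)
proposition2p2 G α α′ =
  mk⇔ ([ return , outflip⇒inflips ]′ ⋆) (Star.map inj₁) ,
  mk⇔ ([ inflip⇒outflips , return ]′ ⋆) (Star.map inj₂)
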